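{- Let $k,m$ be positive integers such that Hadamard matrices of orders $k$ and $m$ exist. Then there exists a balancedly splittable Hadamard matrix of order $km$ with parameters $(km,k(m-1),0,-k)$.
   Context: A Hadamard matrix of order $n$ is an $n\times n$ $\{1,-1\}$-matrix $H$ with $HH^\top=nI_n$; $J_n$ is the all-ones matrix. $H$ is balancedly splittable with parameters $(n,\ell,a,b)$ if, after permuting its rows, $H=\begin{pmatrix}H_1\\H_2\end{pmatrix}$ with $H_1$ an $\ell\times n$ matrix such that $H_1^\top H_1=\ell I_n+aA+b(J_n-A-I_n)$ for a symmetric $(0,1)$-matrix $A$ with zero diagonal. -}

module Defs where

open import Data.Nat as ℕ using (ℕ; zero; suc; _≤_)
open import Data.Integer using (ℤ; +_; -_; _+_; _*_; _-_; 0ℤ; 1ℤ)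
open import Data.Fin using (Fin; inject≤; _≟_) renaming (zero to fzero; suc to fsuc)
open import Relation.Nullary using (yes; no)
open import Data.Fin.Permutation using (Permutation′; _⟨$⟩ʳ_)
open import Data.Product using (Σ; _×_; ∃)
open import Data.Sum using (_⊎_)
open import Relation.Binary.PropositionalEquality using (_≡_; _≢_)

Matrix : ℕ → ℕ → Set
Matrix m n = Fin m → Fin n → ℤ

Σℤ : (n : ℕ) → (Fin n → ℤ) → ℤ
Σℤ zero    f = 0ℤ
Σℤ (suc n) f = f fzero + Σℤ n (λ i → f (fsuc i))

δ : {n : ℕ} → Fin n → Fin n → ℤ
δ i j with i ≟ j
... | yes _ = 1ℤ
... | no _  = 0ℤ

-- (M Mᵀ) i j and (Mᵀ M) i j
_·ᵀ_ : {m n : ℕ} → Matrix m n → Fin m → Fin m → ℤ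
_·ᵀ_ {m} {n} M i j = Σℤ n (λ c → M i c * M j c)

Gram : {ℓ n : ℕ} → Matrix ℓ n → Fin n → Fin n → ℤ
Gram {ℓ} {n} M i j = Σℤ ℓ (λ r → M r i * M r j)

IsPM1 : {m n : ℕ} → Matrix m n → Set
IsPM1 M = ∀ i j → (M i j ≡ 1ℤ) ⊎ (M i j ≡ - 1ℤ)

IsHadamard : (n : ℕ) → Matrix n n → Set
IsHadamard n H = IsPM1 H × (∀ i j → (H ·ᵀ i) j ≡ + n * δ i j)

IsAdjacency : (n : ℕ) → Matrix n n → Set
IsAdjacency n A =
  (∀ i j → (A i j ≡ 0ℤ) ⊎ (A i j ≡ 1ℤ)) ×
  (∀ i j → A i j ≡ A j i) ×
  (∀ i → A i i ≡ 0ℤ)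

topRows : {n : ℕ} (ℓ : ℕ) → ℓ ≤ n → Permutation′ n → Matrix n n → Matrix ℓ n
topRows ℓ ℓ≤n σ H r c = H (σ ⟨$⟩ʳ inject≤ r ℓ≤n) c

-- H is balancedly splittable with parameters (n, ℓ, a, b):
-- after permuting rows, H = (H₁ ; H₂) with H₁ ℓ × n and
-- H₁ᵀ H₁ = ℓ I + a A + b (J - A - I), A symmetric (0,1), zero diagonal.
IsBalancedlySplittable : (n ℓ : ℕ) (a b : ℤ) → Matrix n n → Set
IsBalancedlySplittable n ℓ a b H =
  Σ (ℓ ≤ n) λ ℓ≤n → Σ (Permutation′ n) λ σ → Σ (Matrix n n) λ A →
    IsAdjacency n A ×
    (∀ i j → Gram (topRows ℓ ℓ≤n σ H) i j
               ≡ + ℓ * δ i j + a * A i j + b * (1ℤ - A i j - δ i j))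

module Submission where

-- Let K be a Hadamard matrix of order k and M one of order m = 1 + m'.
-- Multiplying each column of M by its entry in the first row gives a
-- Hadamard matrix N whose first row is all ones.  The Kronecker product
-- H = K ⊗ N is Hadamard of order km.  We order its rows so that the k rows
-- coming from the all-ones row of N are last; the top k(m-1) rows H₁ are
-- then K ⊗ N', where N' is N without its first row, and
--   H₁ᵀ H₁ = (Kᵀ K) ⊗ (N'ᵀ N') = k I ⊗ (m I - J),
-- which is k(m-1) I + 0·A - k (J - A - I) for A = (J - I) ⊗ J.
--
-- The computation needs column orthogonality (Kᵀ K = k I), whereas a
-- Hadamard matrix is given by row orthogonality.  This is the transposition
-- lemma: if H Hᵀ = n I then G = Hᵀ H satisfies tr G = n² and
-- Σ G²ᵢⱼ = Σ (H Hᵀ)²ᵣₛ = n³, so Σ (Gᵢⱼ - n δᵢⱼ)² = 0 and G = n I.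

open import Defs
open import Data.Nat as ℕ using (ℕ; zero; suc; _∸_; NonZero)
import Data.Nat.Properties as ℕP
open import Data.Integer using (ℤ; +_; -_; -[1+_]; _+_; _*_; _-_; 0ℤ; 1ℤ; _≤_; +≤+)
import Data.Integer.Properties as ℤP
open import Data.Integer.Tactic.RingSolver using (solve-∀)
open import Data.Fin using (Fin; _↑ˡ_; _↑ʳ_; combine; remQuot; cast; splitAt; join; _≟_; inject≤)
  renaming (zero to fzero; suc to fsuc)
import Data.Fin.Properties as FinP
import Data.Fin.Permutation as Perm
open import Data.Product using (Σ; _×_; _,_; proj₁; proj₂; uncurry)
open import Data.Sum using (_⊎_; inj₁; inj₂)
open import Data.Empty using (⊥-elim)
open import Relation.Nullary using (¬_; yes; no)
open import Relation.Binary.PropositionalEquality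
open import Function using (_∘_; flip)
import Algebra.Properties.Semiring.Sum as SemiringSum

private module Lib = SemiringSum ℤP.+-*-semiring

Σℤ≡sum : ∀ n (f : Fin n → ℤ) → Σℤ n f ≡ Lib.sum f
Σℤ≡sum zero    f = refl
Σℤ≡sum (suc n) f = cong (λ s → f fzero + s) (Σℤ≡sum n (f ∘ fsuc))

Σℤ²≡sum² : ∀ n m (f : Fin n → Fin m → ℤ) →
  Σℤ n (λ i → Σℤ m (f i)) ≡ Lib.sum (λ i → Lib.sum (f i))
Σℤ²≡sum² n m f = trans (Σℤ≡sum n _) (Lib.sum-cong-≗ (λ i → Σℤ≡sum m (f i)))

Σ-cong : ∀ n {f g : Fin n → ℤ} → (∀ i → f i ≡ g i) → Σℤ n f ≡ Σℤ n g
Σ-cong zero    f≗g = refl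
Σ-cong (suc n) f≗g = cong₂ _+_ (f≗g fzero) (Σ-cong n (f≗g ∘ fsuc))

Σ-+ : ∀ n (f g : Fin n → ℤ) → Σℤ n (λ i → f i + g i) ≡ Σℤ n f + Σℤ n g
Σ-+ n f g = trans (Σℤ≡sum n _)
  (trans (Lib.∑-distrib-+ f g) (sym (cong₂ _+_ (Σℤ≡sum n f) (Σℤ≡sum n g))))

Σ-*ˡ : ∀ n c (f : Fin n → ℤ) → c * Σℤ n f ≡ Σℤ n (λ i → c * f i)
Σ-*ˡ n c f = trans (cong (c *_) (Σℤ≡sum n f))
  (trans (Lib.*-distribˡ-sum c f) (sym (Σℤ≡sum n _)))

Σ-*ʳ : ∀ n c (f : Fin n → ℤ) → Σℤ n f * c ≡ Σℤ n (λ i → f i * c)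
Σ-*ʳ n c f = trans (cong (_* c) (Σℤ≡sum n f))
  (trans (Lib.*-distribʳ-sum c f) (sym (Σℤ≡sum n _)))

Σ-swap : ∀ n m (f : Fin n → Fin m → ℤ) →
  Σℤ n (λ i → Σℤ m (f i)) ≡ Σℤ m (λ j → Σℤ n (λ i → f i j))
Σ-swap n m f = trans (Σℤ²≡sum² n m f)
  (trans (Lib.∑-comm f) (sym (Σℤ²≡sum² m n (flip f))))

Σ-swap-pairs : ∀ n (F : Fin n → Fin n → Fin n → Fin n → ℤ) →
  Σℤ n (λ i → Σℤ n (λ j → Σℤ n (λ r → Σℤ n (λ s → F i j r s))))
    ≡ Σℤ n (λ r → Σℤ n (λ s → Σℤ n (λ i → Σℤ n (λ j → F i j r s))))
Σ-swap-pairs n F = begin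
    Σℤ n (λ i → Σℤ n (λ j → Σℤ n (λ r → Σℤ n (λ s → F i j r s))))
  ≡⟨ Σ-cong n (λ i → Σ-swap n n _) ⟩
    Σℤ n (λ i → Σℤ n (λ r → Σℤ n (λ j → Σℤ n (λ s → F i j r s))))
  ≡⟨ Σ-swap n n _ ⟩
    Σℤ n (λ r → Σℤ n (λ i → Σℤ n (λ j → Σℤ n (λ s → F i j r s))))
  ≡⟨ Σ-cong n (λ r → Σ-cong n (λ i → Σ-swap n n _)) ⟩
    Σℤ n (λ r → Σℤ n (λ i → Σℤ n (λ s → Σℤ n (λ j → F i j r s))))
  ≡⟨ Σ-cong n (λ r → Σ-swap n n _) ⟩
    Σℤ n (λ r → Σℤ n (λ s → Σℤ n (λ i → Σℤ n (λ j → F i j r s)))) ∎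
  where open ≡-Reasoning

Σ-const : ∀ n c → Σℤ n (λ _ → c) ≡ + n * c
Σ-const zero    c = sym (ℤP.*-zeroˡ c)
Σ-const (suc n) c = trans (cong (λ s → c + s) (Σ-const n c)) (sym (ℤP.suc-* (+ n) c))

Σ-prod : ∀ n m (f : Fin n → ℤ) (g : Fin m → ℤ) →
  Σℤ n f * Σℤ m g ≡ Σℤ n (λ i → Σℤ m (λ j → f i * g j))
Σ-prod n m f g = trans (Σ-*ʳ n _ f) (Σ-cong n (λ i → Σ-*ˡ m (f i) g))

Σ-↑ : ∀ m n (f : Fin (m ℕ.+ n) → ℤ) →
  Σℤ (m ℕ.+ n) f ≡ Σℤ m (λ i → f (i ↑ˡ n)) + Σℤ n (λ j → f (m ↑ʳ j))
Σ-↑ zero    n f = sym (ℤP.+-identityˡ _)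
Σ-↑ (suc m) n f = trans (cong (λ s → f fzero + s) (Σ-↑ m n (f ∘ fsuc))) (sym (ℤP.+-assoc (f fzero) _ _))

Σ-combine : ∀ a b (f : Fin (a ℕ.* b) → ℤ) →
  Σℤ (a ℕ.* b) f ≡ Σℤ a (λ i → Σℤ b (λ j → f (combine i j)))
Σ-combine zero    b f = refl
Σ-combine (suc a) b f = trans (Σ-↑ b (a ℕ.* b) f)
  (cong (λ s → Σℤ b (λ j → f (j ↑ˡ (a ℕ.* b))) + s) (Σ-combine a b (f ∘ (b ↑ʳ_))))

Σ-remQuot : ∀ a b (g : Fin a → Fin b → ℤ) →
  Σℤ (a ℕ.* b) (λ c → uncurry g (remQuot {a} b c)) ≡ Σℤ a (λ i → Σℤ b (g i))
Σ-remQuot a b g = trans (Σ-combine a b _)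
  (Σ-cong a (λ i → Σ-cong b (λ j → cong (uncurry g) (FinP.remQuot-combine i j))))

-- Inner products of tensor products of vectors multiply: ⟨x⊗y, x'⊗y'⟩ = ⟨x,x'⟩⟨y,y'⟩.
Σ-tensor : ∀ a b (x x' : Fin a → ℤ) (y y' : Fin b → ℤ) →
  Σℤ (a ℕ.* b) (λ c → (x (proj₁ (remQuot {a} b c)) * y (proj₂ (remQuot {a} b c)))
                    * (x' (proj₁ (remQuot {a} b c)) * y' (proj₂ (remQuot {a} b c))))
    ≡ Σℤ a (λ p → x p * x' p) * Σℤ b (λ q → y q * y' q)
Σ-tensor a b x x' y y' = trans (Σ-remQuot a b (λ p q → (x p * y q) * (x' p * y' q)))
  (trans (Σ-cong a (λ p → Σ-cong b (λ q → regroup (x p) (y q) (x' p) (y' q))))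
         (sym (Σ-prod a b _ _)))
  where
  regroup : ∀ u v w z → (u * v) * (w * z) ≡ (u * w) * (v * z)
  regroup = solve-∀

nonneg-+-zero : ∀ {a b} → 0ℤ ≤ a → 0ℤ ≤ b → a + b ≡ 0ℤ → a ≡ 0ℤ × b ≡ 0ℤ
nonneg-+-zero {a} {b} 0≤a 0≤b a+b≡0 = a≡0 , trans (sym (ℤP.+-identityˡ b)) (subst (λ x → x + b ≡ 0ℤ) a≡0 a+b≡0)
  where
  a≡0 : a ≡ 0ℤ
  a≡0 = ℤP.≤-antisym (subst₂ _≤_ (ℤP.+-identityʳ a) a+b≡0 (ℤP.+-monoʳ-≤ a 0≤b)) 0≤a

Σ-nonneg : ∀ n (f : Fin n → ℤ) → (∀ i → 0ℤ ≤ f i) → 0ℤ ≤ Σℤ n f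
Σ-nonneg zero    f f≥0 = +≤+ ℕ.z≤n
Σ-nonneg (suc n) f f≥0 = ℤP.+-mono-≤ (f≥0 fzero) (Σ-nonneg n (f ∘ fsuc) (f≥0 ∘ fsuc))

Σ-nonneg-zero : ∀ n (f : Fin n → ℤ) → (∀ i → 0ℤ ≤ f i) → Σℤ n f ≡ 0ℤ → ∀ i → f i ≡ 0ℤ
Σ-nonneg-zero (suc n) f f≥0 Σf≡0 = λ
  { fzero    → proj₁ head-and-tail
  ; (fsuc i) → Σ-nonneg-zero n (f ∘ fsuc) (f≥0 ∘ fsuc) (proj₂ head-and-tail) i
  }
  where
  head-and-tail : f fzero ≡ 0ℤ × Σℤ n (f ∘ fsuc) ≡ 0ℤ
  head-and-tail = nonneg-+-zero (f≥0 fzero) (Σ-nonneg n (f ∘ fsuc) (f≥0 ∘ fsuc)) Σf≡0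

square-nonneg : ∀ x → 0ℤ ≤ x * x
square-nonneg (+ n)    = subst (0ℤ ≤_) (ℤP.pos-* n n) (+≤+ ℕ.z≤n)
square-nonneg -[1+ n ] = +≤+ ℕ.z≤n

square-zero : ∀ x → x * x ≡ 0ℤ → x ≡ 0ℤ
square-zero x x²≡0 with ℤP.i*j≡0⇒i≡0∨j≡0 x x²≡0
... | inj₁ x≡0 = x≡0
... | inj₂ x≡0 = x≡0

δ-refl : ∀ {n} (i : Fin n) → δ i i ≡ 1ℤ
δ-refl i with i ≟ i
... | yes _   = refl
... | no  i≢i = ⊥-elim (i≢i refl)

δ-≢ : ∀ {n} {i j : Fin n} → ¬ i ≡ j → δ i j ≡ 0ℤ
δ-≢ {i = i} {j} i≢j with i ≟ j
... | yes i≡j = ⊥-elim (i≢j i≡j)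
... | no  _   = refl

δ-sym : ∀ {n} (i j : Fin n) → δ i j ≡ δ j i
δ-sym i j with i ≟ j
... | yes refl = sym (δ-refl i)
... | no  i≢j  = sym (δ-≢ (i≢j ∘ sym))

δ-01 : ∀ {n} (i j : Fin n) → (δ i j ≡ 0ℤ) ⊎ (δ i j ≡ 1ℤ)
δ-01 i j with i ≟ j
... | yes _ = inj₂ refl
... | no  _ = inj₁ refl

δ-suc : ∀ {n} (i j : Fin n) → δ (fsuc i) (fsuc j) ≡ δ i j
δ-suc i j with i ≟ j
... | yes _ = refl
... | no  _ = refl

Σ-δ : ∀ n (f : Fin n → ℤ) i → Σℤ n (λ j → f j * δ i j) ≡ f i
Σ-δ (suc n) f fzero = begin
    f fzero * δ {suc n} fzero fzero + Σℤ n (λ j → f (fsuc j) * δ {suc n} fzero (fsuc j))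
  ≡⟨ cong₂ _+_ (cong (f fzero *_) (δ-refl {suc n} fzero))
       (Σ-cong n (λ j → trans (cong (f (fsuc j) *_) (δ-≢ {i = fzero} {j = fsuc j} λ ())) (ℤP.*-zeroʳ (f (fsuc j))))) ⟩
    f fzero * 1ℤ + Σℤ n (λ _ → 0ℤ)
  ≡⟨ cong₂ _+_ (ℤP.*-identityʳ (f fzero)) (trans (Σ-const n 0ℤ) (ℤP.*-zeroʳ (+ n))) ⟩
    f fzero + 0ℤ
  ≡⟨ ℤP.+-identityʳ _ ⟩
    f fzero ∎
  where open ≡-Reasoning
Σ-δ (suc n) f (fsuc i) = begin
    f fzero * δ (fsuc i) fzero + Σℤ n (λ j → f (fsuc j) * δ (fsuc i) (fsuc j))
  ≡⟨ cong₂ (λ d e → f fzero * d + e) (δ-≢ {i = fsuc i} {j = fzero} λ ())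
       (Σ-cong n (λ j → cong (f (fsuc j) *_) (δ-suc i j))) ⟩
    f fzero * 0ℤ + Σℤ n (λ j → f (fsuc j) * δ i j)
  ≡⟨ cong (_+ Σℤ n (λ j → f (fsuc j) * δ i j)) (ℤP.*-zeroʳ (f fzero)) ⟩
    0ℤ + Σℤ n (λ j → f (fsuc j) * δ i j)
  ≡⟨ trans (ℤP.+-identityˡ _) (Σ-δ n (f ∘ fsuc) i) ⟩
    f (fsuc i) ∎
  where open ≡-Reasoning

δ-pair-≢ : ∀ {a b} {p p' : Fin a} {q q' : Fin b} → ¬ (p ≡ p' × q ≡ q') → δ p p' * δ q q' ≡ 0ℤ
δ-pair-≢ {p = p} {p'} {q} {q'} ≢ with p ≟ p' | q ≟ q'
... | yes p≡p' | yes q≡q' = ⊥-elim (≢ (p≡p' , q≡q'))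
... | yes _    | no  _    = refl
... | no  _    | _        = refl

δ-pair : ∀ {n a b} (φ : Fin n → Fin a × Fin b) (ψ : Fin a × Fin b → Fin n) →
  (∀ r → ψ (φ r) ≡ r) → ∀ r r' →
  δ r r' ≡ δ (proj₁ (φ r)) (proj₁ (φ r')) * δ (proj₂ (φ r)) (proj₂ (φ r'))
δ-pair φ ψ ψ∘φ r r' with r ≟ r'
... | yes refl = sym (cong₂ _*_ (δ-refl (proj₁ (φ r))) (δ-refl (proj₂ (φ r))))
... | no  r≢r' = sym (δ-pair-≢ λ { (≡₁ , ≡₂) →
        r≢r' (trans (sym (ψ∘φ r)) (trans (cong ψ (cong₂ _,_ ≡₁ ≡₂)) (ψ∘φ r'))) })

PM : ℤ → Set
PM x = (x ≡ 1ℤ) ⊎ (x ≡ - 1ℤ)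

pm-* : ∀ {x y} → PM x → PM y → PM (x * y)
pm-* (inj₁ refl) (inj₁ refl) = inj₁ refl
pm-* (inj₁ refl) (inj₂ refl) = inj₂ refl
pm-* (inj₂ refl) (inj₁ refl) = inj₂ refl
pm-* (inj₂ refl) (inj₂ refl) = inj₁ refl

pm-square : ∀ {x} → PM x → x * x ≡ 1ℤ
pm-square (inj₁ refl) = refl
pm-square (inj₂ refl) = refl

trace-Gram : ∀ {ℓ n} (M : Matrix ℓ n) → Σℤ n (λ i → Gram M i i) ≡ Σℤ ℓ (λ r → (M ·ᵀ r) r)
trace-Gram {ℓ} {n} M = Σ-swap n ℓ _

frobenius-Gram : ∀ {n} (M : Matrix n n) →
  Σℤ n (λ i → Σℤ n (λ j → Gram M i j * Gram M i j))
    ≡ Σℤ n (λ r → Σℤ n (λ s → (M ·ᵀ r) s * (M ·ᵀ r) s))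
frobenius-Gram {n} M = begin
    Σℤ n (λ i → Σℤ n (λ j → Gram M i j * Gram M i j))
  ≡⟨ Σ-cong n (λ i → Σ-cong n (λ j → Σ-prod n n _ _)) ⟩
    Σℤ n (λ i → Σℤ n (λ j → Σℤ n (λ r → Σℤ n (λ s → (M r i * M r j) * (M s i * M s j)))))
  ≡⟨ Σ-swap-pairs n _ ⟩
    Σℤ n (λ r → Σℤ n (λ s → Σℤ n (λ i → Σℤ n (λ j → (M r i * M r j) * (M s i * M s j)))))
  ≡⟨ Σ-cong n (λ r → Σ-cong n (λ s → Σ-cong n (λ i → Σ-cong n (λ j →
       regroup (M r i) (M r j) (M s i) (M s j))))) ⟩
    Σℤ n (λ r → Σℤ n (λ s → Σℤ n (λ i → Σℤ n (λ j → (M r i * M s i) * (M r j * M s j)))))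
  ≡⟨ Σ-cong n (λ r → Σ-cong n (λ s → sym (Σ-prod n n _ _))) ⟩
    Σℤ n (λ r → Σℤ n (λ s → (M ·ᵀ r) s * (M ·ᵀ r) s)) ∎
  where
  open ≡-Reasoning
  regroup : ∀ a b c d → (a * b) * (c * d) ≡ (a * c) * (b * d)
  regroup = solve-∀

Σ-deviation-row : ∀ n (g : Fin n → ℤ) c i →
  Σℤ n (λ j → (g j - c * δ i j) * (g j - c * δ i j))
    ≡ Σℤ n (λ j → g j * g j) + (- (+ 2 * c)) * g i + c * c
Σ-deviation-row n g c i = begin
    Σℤ n (λ j → (g j - c * δ i j) * (g j - c * δ i j))
  ≡⟨ Σ-cong n (λ j → expand (g j) c (δ i j)) ⟩
    Σℤ n (λ j → g j * g j + (- (+ 2 * c)) * (g j * δ i j) + (c * c) * (δ i j * δ i j))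
  ≡⟨ trans (Σ-+ n _ _) (cong₂ _+_ (Σ-+ n _ _) (sym (Σ-*ˡ n (c * c) _))) ⟩
    Σℤ n (λ j → g j * g j) + Σℤ n (λ j → (- (+ 2 * c)) * (g j * δ i j))
      + (c * c) * Σℤ n (λ j → δ i j * δ i j)
  ≡⟨ cong₂ (λ u v → Σℤ n (λ j → g j * g j) + u + (c * c) * v)
       (trans (sym (Σ-*ˡ n (- (+ 2 * c)) _)) (cong (- (+ 2 * c) *_) (Σ-δ n g i)))
       (trans (Σ-δ n (δ i) i) (δ-refl i)) ⟩
    Σℤ n (λ j → g j * g j) + (- (+ 2 * c)) * g i + (c * c) * 1ℤ
  ≡⟨ cong (λ s → Σℤ n (λ j → g j * g j) + (- (+ 2 * c)) * g i + s) (ℤP.*-identityʳ (c * c)) ⟩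
    Σℤ n (λ j → g j * g j) + (- (+ 2 * c)) * g i + c * c ∎
  where
  open ≡-Reasoning
  expand : ∀ x c d → (x - c * d) * (x - c * d) ≡ x * x + (- (+ 2 * c)) * (x * d) + (c * c) * (d * d)
  expand = solve-∀

Σ-deviation : ∀ n (G : Fin n → Fin n → ℤ) c →
  Σℤ n (λ i → Σℤ n (λ j → (G i j - c * δ i j) * (G i j - c * δ i j)))
    ≡ Σℤ n (λ i → Σℤ n (λ j → G i j * G i j)) + (- (+ 2 * c)) * Σℤ n (λ i → G i i) + + n * (c * c)
Σ-deviation n G c = begin
    Σℤ n (λ i → Σℤ n (λ j → (G i j - c * δ i j) * (G i j - c * δ i j)))
  ≡⟨ Σ-cong n (λ i → Σ-deviation-row n (G i) c i) ⟩
    Σℤ n (λ i → Σℤ n (λ j → G i j * G i j) + (- (+ 2 * c)) * G i i + c * c)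
  ≡⟨ trans (Σ-+ n _ _) (cong₂ _+_ (Σ-+ n _ _) (Σ-const n (c * c))) ⟩
    Σℤ n (λ i → Σℤ n (λ j → G i j * G i j)) + Σℤ n (λ i → (- (+ 2 * c)) * G i i) + + n * (c * c)
  ≡⟨ cong (λ t → Σℤ n (λ i → Σℤ n (λ j → G i j * G i j)) + t + + n * (c * c))
       (sym (Σ-*ˡ n (- (+ 2 * c)) (λ i → G i i))) ⟩
    Σℤ n (λ i → Σℤ n (λ j → G i j * G i j)) + (- (+ 2 * c)) * Σℤ n (λ i → G i i) + + n * (c * c) ∎
  where open ≡-Reasoning

columns-orthogonal : ∀ n (H : Matrix n n) → (∀ r s → (H ·ᵀ r) s ≡ + n * δ r s) →
  ∀ i j → Gram H i j ≡ + n * δ i j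
columns-orthogonal n H HHᵀ=nI i j =
  ℤP.i-j≡0⇒i≡j _ _ (square-zero (X i j)
    (Σ-nonneg-zero n (λ j → X i j * X i j) (λ j → square-nonneg (X i j))
      (Σ-nonneg-zero n (λ i → Σℤ n (λ j → X i j * X i j))
        (λ i → Σ-nonneg n _ (λ j → square-nonneg (X i j))) ‖X‖²≡0 i) j))
  where
  open ≡-Reasoning
  G : Fin n → Fin n → ℤ
  G = Gram H
  X : Fin n → Fin n → ℤ
  X i j = G i j - + n * δ i j

  row-norm : ∀ r → Σℤ n (λ s → (H ·ᵀ r) s * (H ·ᵀ r) s) ≡ + n * + n
  row-norm r = begin
      Σℤ n (λ s → (H ·ᵀ r) s * (H ·ᵀ r) s)
    ≡⟨ Σ-cong n (λ s → trans (cong₂ _*_ (HHᵀ=nI r s) (HHᵀ=nI r s)) (regroup (+ n) (δ r s))) ⟩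
      Σℤ n (λ s → (+ n * + n * δ r s) * δ r s)
    ≡⟨ Σ-δ n (λ s → + n * + n * δ r s) r ⟩
      + n * + n * δ r r
    ≡⟨ trans (cong (+ n * + n *_) (δ-refl r)) (ℤP.*-identityʳ _) ⟩
      + n * + n ∎
    where
    regroup : ∀ x d → (x * d) * (x * d) ≡ (x * x * d) * d
    regroup = solve-∀

  trace : Σℤ n (λ i → G i i) ≡ + n * + n
  trace = begin
      Σℤ n (λ i → G i i)
    ≡⟨ trace-Gram H ⟩
      Σℤ n (λ r → (H ·ᵀ r) r)
    ≡⟨ Σ-cong n (λ r → trans (HHᵀ=nI r r) (trans (cong (+ n *_) (δ-refl r)) (ℤP.*-identityʳ _))) ⟩
      Σℤ n (λ _ → + n)
    ≡⟨ Σ-const n (+ n) ⟩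
      + n * + n ∎

  ‖G‖² : Σℤ n (λ i → Σℤ n (λ j → G i j * G i j)) ≡ + n * (+ n * + n)
  ‖G‖² = trans (frobenius-Gram H) (trans (Σ-cong n row-norm) (Σ-const n _))

  ‖X‖²≡0 : Σℤ n (λ i → Σℤ n (λ j → X i j * X i j)) ≡ 0ℤ
  ‖X‖²≡0 = begin
      Σℤ n (λ i → Σℤ n (λ j → X i j * X i j))
    ≡⟨ Σ-deviation n G (+ n) ⟩
      Σℤ n (λ i → Σℤ n (λ j → G i j * G i j)) + (- (+ 2 * + n)) * Σℤ n (λ i → G i i) + + n * (+ n * + n)
    ≡⟨ cong₂ (λ u v → u + (- (+ 2 * + n)) * v + + n * (+ n * + n)) ‖G‖² trace ⟩
      + n * (+ n * + n) + (- (+ 2 * + n)) * (+ n * + n) + + n * (+ n * + n)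
    ≡⟨ cancel (+ n) ⟩
      0ℤ ∎
    where
    cancel : ∀ x → x * (x * x) + (- (+ 2 * x)) * (x * x) + x * (x * x) ≡ 0ℤ
    cancel = solve-∀

normalise : ∀ {m'} → Matrix (suc m') (suc m') → Matrix (suc m') (suc m')
normalise M i j = M i j * M fzero j

normalise-hadamard : ∀ {m'} (M : Matrix (suc m') (suc m')) → IsHadamard (suc m') M →
  IsHadamard (suc m') (normalise M)
normalise-hadamard {m'} M (pmM , MMᵀ) = pmN , NNᵀ
  where
  pmN : IsPM1 (normalise M)
  pmN i j = pm-* (pmM i j) (pmM fzero j)

  NNᵀ : ∀ i i' → (normalise M ·ᵀ i) i' ≡ + suc m' * δ i i'
  NNᵀ i i' = trans (Σ-cong (suc m') (λ j →
      trans (regroup (M i j) (M i' j) (M fzero j))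
            (trans (cong (M i j * M i' j *_) (pm-square (pmM fzero j))) (ℤP.*-identityʳ (M i j * M i' j)))))
    (MMᵀ i i')
    where
    regroup : ∀ a b c → (a * c) * (b * c) ≡ (a * b) * (c * c)
    regroup = solve-∀

normalise-first-row : ∀ {m'} (M : Matrix (suc m') (suc m')) → IsPM1 M →
  ∀ j → normalise M fzero j ≡ 1ℤ
normalise-first-row M pmM j = pm-square (pmM fzero j)

Gram-tail : ∀ {m'} (N : Matrix (suc m') (suc m')) →
  (∀ j → N fzero j ≡ 1ℤ) → (∀ j j' → Gram N j j' ≡ + suc m' * δ j j') →
  ∀ j j' → Σℤ m' (λ i → N (fsuc i) j * N (fsuc i) j') ≡ + suc m' * δ j j' - 1ℤ
Gram-tail {m'} N ones NᵀN j j' = begin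
    tail
  ≡⟨ shift tail ⟩
    1ℤ * 1ℤ + tail - 1ℤ
  ≡⟨ cong (λ x → x + tail - 1ℤ) (sym (cong₂ _*_ (ones j) (ones j'))) ⟩
    Gram N j j' - 1ℤ
  ≡⟨ cong (_- 1ℤ) (NᵀN j j') ⟩
    + suc m' * δ j j' - 1ℤ ∎
  where
  open ≡-Reasoning
  tail : ℤ
  tail = Σℤ m' (λ i → N (fsuc i) j * N (fsuc i) j')
  shift : ∀ t → t ≡ 1ℤ * 1ℤ + t - 1ℤ
  shift = solve-∀

-- Rows of K ⊗ N are indexed by pairs (a , i); we enumerate
-- Fin (k * (1 + m')) ≅ Fin (k * m') ⊎ Fin k ≅ (Fin k × Fin m') ⊎ Fin k so that
-- the pairs (a , 0) come last and the first k * m' indices are the (a , 1 + i).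

module RowOrder (k m' : ℕ) where

  k*m≡k*m'+k : k ℕ.* suc m' ≡ k ℕ.* m' ℕ.+ k
  k*m≡k*m'+k = trans (ℕP.*-suc k m') (ℕP.+-comm k (k ℕ.* m'))

  pairOf : Fin (k ℕ.* m') ⊎ Fin k → Fin k × Fin (suc m')
  pairOf (inj₁ t) = proj₁ (remQuot {k} m' t) , fsuc (proj₂ (remQuot {k} m' t))
  pairOf (inj₂ a) = a , fzero

  unpair : Fin k × Fin (suc m') → Fin (k ℕ.* m') ⊎ Fin k
  unpair (a , fzero)  = inj₂ a
  unpair (a , fsuc i) = inj₁ (combine a i)

  unpair∘pairOf : ∀ x → unpair (pairOf x) ≡ x
  unpair∘pairOf (inj₁ t) = cong inj₁ (FinP.combine-remQuot {k} m' t)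
  unpair∘pairOf (inj₂ a) = refl

  ρ : Fin (k ℕ.* suc m') → Fin k × Fin (suc m')
  ρ r = pairOf (splitAt (k ℕ.* m') (cast k*m≡k*m'+k r))

  ρ⁻¹ : Fin k × Fin (suc m') → Fin (k ℕ.* suc m')
  ρ⁻¹ y = cast (sym k*m≡k*m'+k) (join (k ℕ.* m') k (unpair y))

  ρ⁻¹∘ρ : ∀ r → ρ⁻¹ (ρ r) ≡ r
  ρ⁻¹∘ρ r = begin
      cast (sym k*m≡k*m'+k) (join (k ℕ.* m') k (unpair (pairOf (splitAt (k ℕ.* m') r'))))
    ≡⟨ cong (cast (sym k*m≡k*m'+k) ∘ join (k ℕ.* m') k) (unpair∘pairOf (splitAt (k ℕ.* m') r')) ⟩
      cast (sym k*m≡k*m'+k) (join (k ℕ.* m') k (splitAt (k ℕ.* m') r'))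
    ≡⟨ cong (cast (sym k*m≡k*m'+k)) (FinP.join-splitAt (k ℕ.* m') k r') ⟩
      cast (sym k*m≡k*m'+k) r'
    ≡⟨ FinP.cast-involutive (sym k*m≡k*m'+k) k*m≡k*m'+k r ⟩
      r ∎
    where
    open ≡-Reasoning
    r' : Fin (k ℕ.* m' ℕ.+ k)
    r' = cast k*m≡k*m'+k r

  top≤ : k ℕ.* m' ℕ.≤ k ℕ.* suc m'
  top≤ = ℕP.*-monoʳ-≤ k (ℕP.n≤1+n m')

  ρ-top : ∀ (t : Fin (k ℕ.* m')) → ρ (inject≤ t top≤) ≡ pairOf (inj₁ t)
  ρ-top t = trans (cong (pairOf ∘ splitAt (k ℕ.* m')) cast-inject)
                  (cong pairOf (FinP.splitAt-↑ˡ (k ℕ.* m') t k))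
    where
    cast-inject : cast k*m≡k*m'+k (inject≤ t top≤) ≡ t ↑ˡ k
    cast-inject = FinP.toℕ-injective (trans (FinP.toℕ-cast k*m≡k*m'+k _)
      (trans (FinP.toℕ-inject≤ t top≤) (sym (FinP.toℕ-↑ˡ t k))))

module Construction {k m' : ℕ} (K : Matrix k k) (hK : IsHadamard k K)
                    (N : Matrix (suc m') (suc m')) (hN : IsHadamard (suc m') N)
                    (ones : ∀ j → N fzero j ≡ 1ℤ) where
  open RowOrder k m'

  m : ℕ
  m = suc m'

  κ : Fin (k ℕ.* m) → Fin k × Fin m
  κ = remQuot {k} m

  H : Matrix (k ℕ.* m) (k ℕ.* m)
  H r c = K (proj₁ (ρ r)) (proj₁ (κ c)) * N (proj₂ (ρ r)) (proj₂ (κ c))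

  H-pm : IsPM1 H
  H-pm r c = pm-* (proj₁ hK (proj₁ (ρ r)) (proj₁ (κ c))) (proj₁ hN (proj₂ (ρ r)) (proj₂ (κ c)))

  -- (K ⊗ N)(K ⊗ N)ᵀ = K Kᵀ ⊗ N Nᵀ = km I.
  H-rows : ∀ r r' → (H ·ᵀ r) r' ≡ + (k ℕ.* m) * δ r r'
  H-rows r r' = begin
      (H ·ᵀ r) r'
    ≡⟨ Σ-tensor k m (K a) (K a') (N i) (N i') ⟩
      (K ·ᵀ a) a' * (N ·ᵀ i) i'
    ≡⟨ cong₂ _*_ (proj₂ hK a a') (proj₂ hN i i') ⟩
      (+ k * δ a a') * (+ m * δ i i')
    ≡⟨ regroup (+ k) (+ m) (δ a a') (δ i i') ⟩
      (+ k * + m) * (δ a a' * δ i i')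
    ≡⟨ cong₂ _*_ (sym (ℤP.pos-* k m)) (sym (δ-pair ρ ρ⁻¹ ρ⁻¹∘ρ r r')) ⟩
      + (k ℕ.* m) * δ r r' ∎
    where
    open ≡-Reasoning
    a a' : Fin k
    a = proj₁ (ρ r)
    a' = proj₁ (ρ r')
    i i' : Fin m
    i = proj₂ (ρ r)
    i' = proj₂ (ρ r')
    regroup : ∀ x y d e → (x * d) * (y * e) ≡ (x * y) * (d * e)
    regroup = solve-∀

  -- Columns c, c' are adjacent when they lie in different blocks, i.e. A = (J - I) ⊗ J.
  A : Matrix (k ℕ.* m) (k ℕ.* m)
  A c c' = 1ℤ - δ (proj₁ (κ c)) (proj₁ (κ c'))

  A-adjacency : IsAdjacency (k ℕ.* m) A
  A-adjacency = (λ c c' → flip01 (δ-01 (proj₁ (κ c)) (proj₁ (κ c'))))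
              , (λ c c' → cong (λ d → 1ℤ - d) (δ-sym (proj₁ (κ c)) (proj₁ (κ c'))))
              , (λ c → cong (λ d → 1ℤ - d) (δ-refl (proj₁ (κ c))))
    where
    flip01 : ∀ {d} → (d ≡ 0ℤ) ⊎ (d ≡ 1ℤ) → (1ℤ - d ≡ 0ℤ) ⊎ (1ℤ - d ≡ 1ℤ)
    flip01 (inj₁ refl) = inj₂ refl
    flip01 (inj₂ refl) = inj₁ refl

  H₁ : Matrix (k ℕ.* m') (k ℕ.* m)
  H₁ = topRows (k ℕ.* m') top≤ Perm.id H

  -- H₁ᵀ H₁ = Kᵀ K ⊗ N'ᵀ N' = k I ⊗ (m I - J) = k(m-1) I + 0 A - k (J - A - I).
  H₁-Gram : ∀ c c' → Gram H₁ c c' ≡ + (k ℕ.* m') * δ c c' + 0ℤ * A c c' + - (+ k) * (1ℤ - A c c' - δ c c')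
  H₁-Gram c c' = begin
      Gram H₁ c c'
    ≡⟨ Σ-cong (k ℕ.* m') (λ t → cong (λ p → (K (proj₁ p) b * N (proj₂ p) j) * (K (proj₁ p) b' * N (proj₂ p) j'))
         (ρ-top t)) ⟩
      Σℤ (k ℕ.* m') (λ t → (K (proj₁ (remQuot {k} m' t)) b * N (fsuc (proj₂ (remQuot {k} m' t))) j)
                          * (K (proj₁ (remQuot {k} m' t)) b' * N (fsuc (proj₂ (remQuot {k} m' t))) j'))
    ≡⟨ Σ-tensor k m' (λ a → K a b) (λ a → K a b') (λ i → N (fsuc i) j) (λ i → N (fsuc i) j') ⟩
      Gram K b b' * Σℤ m' (λ i → N (fsuc i) j * N (fsuc i) j')
    ≡⟨ cong₂ _*_ (columns-orthogonal k K (proj₂ hK) b b')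
                 (Gram-tail N ones (columns-orthogonal m N (proj₂ hN)) j j') ⟩
      (+ k * δ b b') * (+ m * δ j j' - 1ℤ)
    ≡⟨ rearrange (+ k) (+ m') (δ b b') (δ j j') ⟩
      (+ k * + m') * (δ b b' * δ j j') + 0ℤ * (1ℤ - δ b b') + - (+ k) * (1ℤ - (1ℤ - δ b b') - δ b b' * δ j j')
    ≡⟨ cong₂ (λ u v → u * v + 0ℤ * (1ℤ - δ b b') + - (+ k) * (1ℤ - (1ℤ - δ b b') - v))
         (sym (ℤP.pos-* k m')) (sym (δ-pair κ (uncurry combine) (FinP.combine-remQuot {k} m) c c')) ⟩
      + (k ℕ.* m') * δ c c' + 0ℤ * A c c' + - (+ k) * (1ℤ - A c c' - δ c c') ∎
    where
    open ≡-Reasoning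
    b b' : Fin k
    b = proj₁ (κ c)
    b' = proj₁ (κ c')
    j j' : Fin m
    j = proj₂ (κ c)
    j' = proj₂ (κ c')
    rearrange : ∀ x y d e → (x * d) * ((1ℤ + y) * e - 1ℤ)
      ≡ (x * y) * (d * e) + 0ℤ * (1ℤ - d) + - x * (1ℤ - (1ℤ - d) - d * e)
    rearrange = solve-∀

theorem3p3 : (k m : ℕ) → .{{NonZero k}} → .{{NonZero m}} →
    Σ (Matrix k k) (IsHadamard k) → Σ (Matrix m m) (IsHadamard m) →
    Σ (Matrix (k ℕ.* m) (k ℕ.* m)) λ H →
    IsHadamard (k ℕ.* m) H ×
    IsBalancedlySplittable (k ℕ.* m) (k ℕ.* (m ∸ 1)) 0ℤ (- (+ k)) H
theorem3p3 k (suc m') (K , hK) (M , hM) =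
  H , (H-pm , H-rows) , top≤ , Perm.id , A , A-adjacency , H₁-Gram
  where
  open RowOrder k m' using (top≤)
  open Construction K hK (normalise M) (normalise-hadamard M hM)
                        (normalise-first-row M (proj₁ hM))
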